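{- Let $n\ge 3$ and let $\mathcal{F}\subset\mathcal{P}([n])$ be a left-compressed up-set which is both $3$-wise intersecting and $3$-intersecting. Let $\mathcal{G}$ be the set of minimal elements of $\mathcal{F}$ and $\mathcal{G}_0=\{A\in\mathcal{G}: n\in A\}$. If for some $i<n-1$ there is an $(i,n-1)$-sharp pair in $\mathcal{G}_0$, then $\mathcal{F}$ is almost-trivial, i.e. every $C\in\mathcal{F}$ with $|C|\le n-3$ contains $1$.
   Context: A family is $3$-wise intersecting if any three (not necessarily distinct) members have nonempty common intersection, and $3$-intersecting if any two members intersect in at least $3$ elements. A family is left-compressed if for all $1\le i<j\le n$ and $A\in\mathcal{F}$ with $j\in A$, $i\notin A$, we have $(A\setminus\{j\})\cup\{i\}\in\mathcal{F}$; an up-set is a family closed under taking supersets within $[n]$. For $i<j<n$, an $(i,j)$-sharp pair in $\mathcal{G}_0$ is a pair $(A,B)$ of sets in $\mathcal{G}_0$ with $A\cup B=[n]$ and $A\cap B=\{i,j,n\}$. -}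

module Defs where

open import Data.Nat using (ℕ; suc; _+_; _≤_; _∸_)
open import Data.Fin using (Fin; zero; fromℕ; inject₁) renaming (_<_ to _<ᶠ_)
open import Data.Fin.Subset
open import Data.Product using (Σ; _×_; ∃)
open import Relation.Nullary using (¬_)
open import Relation.Binary.PropositionalEquality using (_≡_)

-- Ground set [n] is represented by Fin n: the paper's element t (1 ≤ t ≤ n)
-- is the index t-1 : Fin n.  A family is a predicate on subsets.
Family : ℕ → Set₁
Family n = Subset n → Set

ThreeWiseIntersecting : ∀ {n} → Family n → Set
ThreeWiseIntersecting F = ∀ A B C → F A → F B → F C → Nonempty (A ∩ B ∩ C)

ThreeIntersecting : ∀ {n} → Family n → Set
ThreeIntersecting F = ∀ A B → F A → F B → 3 ≤ ∣ A ∩ B ∣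

LeftCompressed : ∀ {n} → Family n → Set
LeftCompressed {n} F = ∀ (i j : Fin n) (A : Subset n) → i <ᶠ j → F A →
  j ∈ A → i ∉ A → F ((A - j) ∪ ⁅ i ⁆)

UpSet : ∀ {n} → Family n → Set
UpSet {n} F = ∀ (A B : Subset n) → F A → A ⊆ B → F B

Minimal : ∀ {n} → Family n → Subset n → Set
Minimal F A = F A × (∀ B → F B → B ⊆ A → B ≡ A)

-- Specialise to n = 3 + k, so the elements n-1 and n exist.
-- The paper's element n:
elN : ∀ k → Fin (3 + k)
elN k = fromℕ (2 + k)

-- The paper's element n-1:
elN-1 : ∀ k → Fin (3 + k)
elN-1 k = inject₁ (fromℕ (1 + k))

G₀ : ∀ k → Family (3 + k) → Subset (3 + k) → Set
G₀ k F A = Minimal F A × elN k ∈ A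

SharpPair : ∀ k → Family (3 + k) → Fin (3 + k) → Fin (3 + k) →
  Subset (3 + k) → Subset (3 + k) → Set
SharpPair k F i j A B =
  G₀ k F A × G₀ k F B × (A ∪ B ≡ ⊤) × (A ∩ B ≡ ⁅ i ⁆ ∪ ⁅ j ⁆ ∪ ⁅ elN k ⁆)

AlmostTrivial : ∀ k → Family (3 + k) → Set
AlmostTrivial k F = ∀ C → F C → ∣ C ∣ ≤ (3 + k) ∸ 3 → zero ∈ C

-- If C ∈ F avoids 1 and |C| ≤ n - 3, then C also avoids two points x < y, so
-- the up-set F contains ∁{1, x, y}.  Left compression lets the missing points
-- of such a complement move upwards, so F contains ∁{i, n-1, n} = ∁(A ∩ B)
-- for the sharp pair (A, B); but A, B and ∁(A ∩ B) have empty common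
-- intersection.
module Submission where

open import Defs
open import Data.Nat using (ℕ; _+_; suc; _≤_; s≤s; z≤n)
open import Data.Nat.Properties using (<-trans; <-≤-trans; ≤-trans; n<1+n)
open import Data.Fin using (Fin; zero; suc; toℕ; fromℕ; _≟_)
  renaming (_<_ to _<ᶠ_; _≤_ to _≤ᶠ_)
open import Data.Fin.Properties
  using (<⇒≢; ≤∧≢⇒<; ≤fromℕ; toℕ-fromℕ; toℕ-inject₁; toℕ≤pred[n])
open import Data.Fin.Subset hiding (⊥)
open import Data.Fin.Subset.Properties
open import Data.Vec using (_∷_; here; there)
open import Data.Product using (Σ; ∃; _×_; _,_; proj₁)
open import Data.Sum using ([_,_]; inj₁; inj₂)
open import Data.Empty using (⊥-elim)
open import Function using (_∘_)
open import Relation.Nullary using (¬_; yes; no)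
open import Relation.Binary.PropositionalEquality
  using (_≡_; _≢_; refl; sym; trans; subst)

private
  variable
    n : ℕ
    x y : Fin n
    p q : Subset n

>⇒≢ : x <ᶠ y → y ≢ x
>⇒≢ x<y = <⇒≢ x<y ∘ sym

x∉p∪q : x ∉ p → x ∉ q → x ∉ p ∪ q
x∉p∪q {p = p} {q} x∉p x∉q = [ x∉p , x∉q ] ∘ x∈p∪q⁻ p q

x∉⁅y⁆∪⁅z⁆ : ∀ {z : Fin n} → x ≢ y → x ≢ z → x ∉ ⁅ y ⁆ ∪ ⁅ z ⁆
x∉⁅y⁆∪⁅z⁆ x≢y x≢z = x∉p∪q (x≢y⇒x∉⁅y⁆ x≢y) (x≢y⇒x∉⁅y⁆ x≢z)

x∈p─q⇒x∉q : x ∈ p ─ q → x ∉ q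
x∈p─q⇒x∉q {p = inside ∷ _} {outside ∷ _} here ()
x∈p─q⇒x∉q {p = _ ∷ _} {_ ∷ _} (there x∈p─q) (there x∈q) = x∈p─q⇒x∉q x∈p─q x∈q

1+∣p∣≤n⇒∃x∉p : (p : Subset n) → suc ∣ p ∣ ≤ n → ∃ λ x → x ∉ p
1+∣p∣≤n⇒∃x∉p (outside ∷ p) _ = zero , λ ()
1+∣p∣≤n⇒∃x∉p (inside ∷ p) (s≤s 1+∣p∣≤n) with 1+∣p∣≤n⇒∃x∉p p 1+∣p∣≤n
... | x , x∉p = suc x , x∉p ∘ drop-there

2+∣p∣≤n⇒∃x<y∉p : (p : Subset n) → 2 + ∣ p ∣ ≤ n →
  ∃ λ x → ∃ λ y → x <ᶠ y × x ∉ p × y ∉ p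
2+∣p∣≤n⇒∃x<y∉p (outside ∷ p) (s≤s 1+∣p∣≤n) with 1+∣p∣≤n⇒∃x∉p p 1+∣p∣≤n
... | y , y∉p = zero , suc y , s≤s z≤n , (λ ()) , y∉p ∘ drop-there
2+∣p∣≤n⇒∃x<y∉p (inside ∷ p) (s≤s 2+∣p∣≤n) with 2+∣p∣≤n⇒∃x<y∉p p 2+∣p∣≤n
... | x , y , x<y , x∉p , y∉p =
  suc x , suc y , s≤s x<y , x∉p ∘ drop-there , y∉p ∘ drop-there

triple : Fin n → Fin n → Fin n → Subset n
triple a b c = ⁅ a ⁆ ∪ ⁅ b ⁆ ∪ ⁅ c ⁆

triple-rotate : (a b c : Fin n) → triple a b c ≡ triple b c a
triple-rotate a b c = trans (∪-comm ⁅ a ⁆ _) (∪-assoc ⁅ b ⁆ ⁅ c ⁆ ⁅ a ⁆)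

⊆∁-triple : ∀ {a b c : Fin n} → a ∉ p → b ∉ p → c ∉ p → p ⊆ ∁ (triple a b c)
⊆∁-triple {p = p} a∉p b∉p c∉p {z} z∈p =
  x∉p⇒x∈∁p (x∉p∪q (x≢y⇒x∉⁅y⁆ (apart a∉p)) (x∉⁅y⁆∪⁅z⁆ (apart b∉p) (apart c∉p)))
  where
  apart : ∀ {a} → a ∉ p → z ≢ a
  apart a∉p refl = a∉p z∈p

∁-∩∉ : {F : Family n} → ThreeWiseIntersecting F →
  ∀ {A B} → F A → F B → ¬ F (∁ (A ∩ B))
∁-∩∉ tw {A} {B} FA FB F∁ with tw A B (∁ (A ∩ B)) FA FB F∁
... | x , x∈A∩B∩∁ with x∈p∩q⁻ A _ x∈A∩B∩∁
... | x∈A , x∈B∩∁ with x∈p∩q⁻ B _ x∈B∩∁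
... | x∈B , x∈∁ = x∈∁p⇒x∉p x∈∁ (x∈p∩q⁺ (x∈A , x∈B))

-- Compressing ∁(⁅ x ⁆ ∪ R) from y to x yields a subset of ∁(⁅ y ⁆ ∪ R).
∁-raise : {F : Family n} → LeftCompressed F → UpSet F →
  ∀ {R} → x ≤ᶠ y → x ∉ R → y ∉ R → F (∁ (⁅ x ⁆ ∪ R)) → F (∁ (⁅ y ⁆ ∪ R))
∁-raise {x = x} {y} {F = F} lc up {R} x≤y x∉R y∉R F∁S with x ≟ y
... | yes refl = F∁S
... | no x≢y = up _ _ compressed compressed⊆
  where
  S : Subset _
  S = ⁅ x ⁆ ∪ R
  compressed : F ((∁ S - y) ∪ ⁅ x ⁆)
  compressed = lc x y (∁ S) (≤∧≢⇒< x≤y x≢y) F∁S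
    (x∉p⇒x∈∁p (x∉p∪q (x≢y⇒x∉⁅y⁆ (x≢y ∘ sym)) y∉R))
    (x∈p⇒x∉∁p (x∈p∪q⁺ (inj₁ (x∈⁅x⁆ x))))
  compressed⊆ : (∁ S - y) ∪ ⁅ x ⁆ ⊆ ∁ (⁅ y ⁆ ∪ R)
  compressed⊆ z∈ with x∈p∪q⁻ (∁ S - y) ⁅ x ⁆ z∈
  ... | inj₁ z∈∁S-y = x∉p⇒x∈∁p (x∉p∪q (x∈p─q⇒x∉q z∈∁S-y)
          (x∈∁p⇒x∉p (p─q⊆p (∁ S) ⁅ y ⁆ z∈∁S-y) ∘ x∈p∪q⁺ ∘ inj₂))
  ... | inj₂ z∈⁅x⁆ rewrite x∈⁅y⁆⇒x≡y x z∈⁅x⁆ =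
          x∉p⇒x∈∁p (x∉p∪q (x≢y⇒x∉⁅y⁆ x≢y) x∉R)

∁-triple-raise : {F : Family n} → LeftCompressed F → UpSet F →
  ∀ {a b c a' b' c'} → a <ᶠ b → b <ᶠ c → a' <ᶠ b' → b' <ᶠ c' →
  a ≤ᶠ a' → b ≤ᶠ b' → c ≤ᶠ c' → F (∁ (triple a b c)) → F (∁ (triple a' b' c'))
∁-triple-raise {F = F} lc up {a} {b} {c} {a'} {b'} {c'} a<b b<c a'<b' b'<c' a≤a' b≤b' c≤c' =
    ∁-raise lc up a≤a' (x∉⁅y⁆∪⁅z⁆ (<⇒≢ a<b') (<⇒≢ a<c'))
      (x∉⁅y⁆∪⁅z⁆ (<⇒≢ a'<b') (<⇒≢ (<-trans a'<b' b'<c')))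
  ∘ rotate ∘ rotate
  ∘ ∁-raise lc up b≤b' (x∉⁅y⁆∪⁅z⁆ (<⇒≢ b<c') (>⇒≢ a<b))
      (x∉⁅y⁆∪⁅z⁆ (<⇒≢ b'<c') (>⇒≢ a<b'))
  ∘ rotate ∘ rotate
  ∘ ∁-raise lc up c≤c' (x∉⁅y⁆∪⁅z⁆ (>⇒≢ a<c) (>⇒≢ b<c))
      (x∉⁅y⁆∪⁅z⁆ (>⇒≢ a<c') (>⇒≢ b<c'))
  ∘ rotate ∘ rotate
  where
  rotate : ∀ {u v w} → F (∁ (triple u v w)) → F (∁ (triple v w u))
  rotate {u} {v} {w} = subst (F ∘ ∁) (triple-rotate u v w)
  a<c : a <ᶠ c
  a<c = <-trans a<b b<c
  b<c' : b <ᶠ c'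
  b<c' = <-≤-trans b<c c≤c'
  a<c' : a <ᶠ c'
  a<c' = <-trans a<b b<c'
  a<b' : a <ᶠ b'
  a<b' = <-≤-trans a<b b≤b'

toℕ-elN-1 : ∀ k → toℕ (elN-1 k) ≡ suc k
toℕ-elN-1 k = trans (toℕ-inject₁ (fromℕ (suc k))) (toℕ-fromℕ (suc k))

elN-1<elN : ∀ k → elN-1 k <ᶠ elN k
elN-1<elN k rewrite toℕ-elN-1 k | toℕ-fromℕ (2 + k) = n<1+n (suc k)

lemma2 : (k : ℕ) (F : Family (3 + k)) → LeftCompressed F → UpSet F →
    ThreeWiseIntersecting F → ThreeIntersecting F →
    (Σ (Fin (3 + k)) λ i → i <ᶠ elN-1 k ×
      ∃ λ A → ∃ λ B → SharpPair k F i (elN-1 k) A B) →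
    AlmostTrivial k F
lemma2 k F lc up tw _ _ (inside ∷ C) _ _ = here
lemma2 k F lc up tw _ (i , i<M , A , B , ((minA , _) , (minB , _) , _ , A∩B≡iMN))
       (outside ∷ C) FC ∣C∣≤k
  with 2+∣p∣≤n⇒∃x<y∉p C (s≤s (s≤s ∣C∣≤k))
... | x , y , x<y , x∉C , y∉C =
  ⊥-elim (∁-∩∉ tw (proj₁ minA) (proj₁ minB) (subst (F ∘ ∁) (sym A∩B≡iMN) F∁iMN))
  where
  F∁0xy : F (∁ (triple zero (suc x) (suc y)))
  F∁0xy = up _ _ FC (⊆∁-triple {a = zero} (λ ()) (x∉C ∘ drop-there) (y∉C ∘ drop-there))
  1+x≤M : suc x ≤ᶠ elN-1 k
  1+x≤M rewrite toℕ-elN-1 k = ≤-trans x<y (toℕ≤pred[n] y)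
  F∁iMN : F (∁ (triple i (elN-1 k) (elN k)))
  F∁iMN = ∁-triple-raise lc up (s≤s z≤n) (s≤s x<y) i<M (elN-1<elN k)
            z≤n 1+x≤M (≤fromℕ (suc y)) F∁0xy
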